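{- Let $r,m \in \mathbb{N}$ and let $G$ be a graph on $n$ vertices with $D(G) \geq n+ 2r-m$. Let $A\subseteq V(G)$ be closed under the $r$-neighbour bootstrap process with $n \neq |A| \geq r$, and write $A^c=V(G)\setminus A$. Then every vertex $x\in A$ has at least $r-m+3$ neighbours in $A^c$. Moreover, if $x\in A$ is not adjacent to all vertices of $A^c$, then $\deg_{A^c}(x)\geq r-m+3+q(x)$, where $q(x)$ is the number of vertices of $A\setminus\{x\}$ not adjacent to $x$.
   Context: In the $r$-neighbour bootstrap process on a graph $G$ with initially infected set $A_0$, one sets $A_t=A_{t-1}\cup\{v: |N(v)\cap A_{t-1}|\geq r\}$; the closure $\langle A_0\rangle=\bigcup_t A_t$, and $A$ is closed if $\langle A\rangle = A$ (equivalently every vertex outside $A$ has at most $r-1$ neighbours in $A$). $\deg_W(v)=|N(v)\cap W|$. $D(G)=\min\{\deg(v)+\deg(w): v\neq w,\ v\not\sim w\}$. -}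

module Defs where

open import Data.Nat using (ℕ; zero; suc; _≤ᵇ_)
open import Data.Bool using (Bool; true; false)
open import Data.Fin using (Fin)
open import Data.Fin.Subset using (Subset; _∈_; _∩_; _∪_; ∁; ∣_∣; _-_)
open import Data.Vec using (tabulate)
open import Data.Product using (∃; _×_)
open import Relation.Binary.PropositionalEquality using (_≡_)

record Graph (n : ℕ) : Set where
  field
    adj    : Fin n → Fin n → Bool
    sym    : ∀ v w → adj v w ≡ adj w v
    irrefl : ∀ v → adj v v ≡ false
open Graph public

module _ {n : ℕ} (G : Graph n) where
  N : Fin n → Subset n
  N v = tabulate (adj G v)

  deg : Fin n → ℕ
  deg v = ∣ N v ∣

  degIn : Subset n → Fin n → ℕ
  degIn W v = ∣ N v ∩ W ∣

  step : ℕ → Subset n → Subset n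
  step r A = A ∪ tabulate (λ v → r ≤ᵇ degIn A v)

  iter : ℕ → Subset n → ℕ → Subset n
  iter r A zero    = A
  iter r A (suc t) = step r (iter r A t)

  _∈⟨_⟩_ : Fin n → Subset n → ℕ → Set
  v ∈⟨ A ⟩ r = ∃ λ t → v ∈ iter r A t

  Closed : ℕ → Subset n → Set
  Closed r A = (∀ v → v ∈⟨ A ⟩ r → v ∈ A) × (∀ v → v ∈ A → v ∈⟨ A ⟩ r)

  q : Subset n → Fin n → ℕ
  q A x = ∣ (A - x) ∩ ∁ (N x) ∣

module Submission where

-- Let x ∈ A and let y ∉ A be a non-neighbour of x.  The
-- degree condition gives  deg x + deg y ≥ n + 2r − m,  while
--   * deg x + q(x) + 1 ≤ |A| + deg_{Aᶜ}(x),  because the neighbours of x in A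
--     and its non-neighbours in A ∖ {x} are disjoint parts of A ∖ {x};
--   * deg y + 2 ≤ r + |Aᶜ|,  because A is closed (y has < r neighbours in A)
--     and y is not its own neighbour.
-- Adding up and using |A| + |Aᶜ| = n yields  deg_{Aᶜ}(x) ≥ r − m + 3 + q(x),
-- which is the second claim.  For the first claim only the case that x is
-- adjacent to all of Aᶜ remains; then pick y ∉ A (A ≠ V) and a non-neighbour
-- z ∈ A of y (y has < r ≤ |A| neighbours in A): the second claim for z gives
-- r − m + 3 ≤ deg_{Aᶜ}(z) ≤ |Aᶜ| = deg_{Aᶜ}(x).

open import Defs
open import Data.Nat using (ℕ; _≤_)
open import Data.Integer using (ℤ; +_; _-_) renaming (_+_ to _+ℤ_; _≤_ to _≤ℤ_)
open import Data.Bool using (true; false)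
open import Data.Fin using (Fin)
open import Data.Fin.Subset using (Subset; _∈_; ∁; ∣_∣)
open import Data.Product using (_×_)
open import Relation.Binary.PropositionalEquality using (_≡_; _≢_)
open import Relation.Nullary using (¬_)

open import Data.Nat using (suc; _+_; _*_; _<_; _≤?_)
open import Data.Nat.Properties
  using (+-suc; +-mono-≤; ≤-antisym; +-monoˡ-≤; +-cancelˡ-≤; ≤-trans; ≤⇒≤ᵇ; ≰⇒>; <⇒≱;
         m≤m+n; m≤n+m; m+n∸n≡m; m+[n∸m]≡n; module ≤-Reasoning)
open import Data.Nat.Solver using (module +-*-Solver)
open import Data.Integer using (_⊖_)
open import Data.Integer.Properties
  using (drop‿+≤+; ⊖-≥; ⊖-monoˡ-≤; distribˡ-⊖-+-pos; [+m]-[+n]≡m⊖n)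
  renaming (+-monoˡ-≤ to +ℤ-monoˡ-≤)
open import Data.Bool.Properties using (T-≡; ¬-not)
open import Data.Fin.Subset using (_∩_; _⊆_; _⊈_; _∉_; ⊤; inside; outside)
  renaming (_-_ to _∖_)
open import Data.Fin.Subset.Properties
  using (∣p∣≤n; ∣⊤∣≡n; ∣∁p∣≡n∸∣p∣; p⊆q⇒∣p∣≤∣q∣; p⊂q⇒∣p∣<∣q∣; ∣p∩q∣≤∣q∣;
         p∩q⊆q; x∈p∩q⁺; x∈p∩q⁻; x∈p∪q⁺; x∈∁p⇒x∉p; x∉∁p⇒x∈p; x∉p⇒x∈∁p;
         x∈p∧x≢y⇒x∈p-y; x∈p⇒∣p-x∣<∣p∣; nonempty?; _⊆?_)
open import Data.Vec using ([]; _∷_)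
open import Data.Vec.Properties using ([]=⇒lookup; lookup⇒[]=; lookup∘tabulate)
open import Data.Product using (∃; _,_; proj₁)
open import Data.Sum using (inj₂)
open import Function.Bundles using (Equivalence)
open import Relation.Nullary using (yes; no; contradiction)
open import Relation.Binary.PropositionalEquality using (refl; trans; cong; subst)
import Relation.Binary.PropositionalEquality as Eq

∣p∩q∣+∣p∩∁q∣≡∣p∣ : ∀ {n} (p q : Subset n) → ∣ p ∩ q ∣ + ∣ p ∩ ∁ q ∣ ≡ ∣ p ∣
∣p∩q∣+∣p∩∁q∣≡∣p∣ []            []            = refl
∣p∩q∣+∣p∩∁q∣≡∣p∣ (inside  ∷ p) (inside  ∷ q) = cong suc (∣p∩q∣+∣p∩∁q∣≡∣p∣ p q)
∣p∩q∣+∣p∩∁q∣≡∣p∣ (inside  ∷ p) (outside ∷ q) =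
  trans (+-suc _ _) (cong suc (∣p∩q∣+∣p∩∁q∣≡∣p∣ p q))
∣p∩q∣+∣p∩∁q∣≡∣p∣ (outside ∷ p) (_       ∷ q) = ∣p∩q∣+∣p∩∁q∣≡∣p∣ p q

∣p∣+∣∁p∣≡n : ∀ {n} (p : Subset n) → ∣ p ∣ + ∣ ∁ p ∣ ≡ n
∣p∣+∣∁p∣≡n p = trans (cong (_+_ ∣ p ∣) (∣∁p∣≡n∸∣p∣ p)) (m+[n∸m]≡n (∣p∣≤n p))

x∉p⇒∣p∩q∣<∣q∣ : ∀ {n x} {p q : Subset n} → x ∈ q → x ∉ p → ∣ p ∩ q ∣ < ∣ q ∣
x∉p⇒∣p∩q∣<∣q∣ {x = x} {p} {q} x∈q x∉p =
  p⊂q⇒∣p∣<∣q∣ (p∩q⊆q p q , x , x∈q , λ x∈p∩q → x∉p (proj₁ (x∈p∩q⁻ p q x∈p∩q)))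

q⊆p⇒∣q∣≤∣p∩q∣ : ∀ {n} {p q : Subset n} → q ⊆ p → ∣ q ∣ ≤ ∣ p ∩ q ∣
q⊆p⇒∣q∣≤∣p∩q∣ q⊆p = p⊆q⇒∣p∣≤∣q∣ (λ x∈q → x∈p∩q⁺ (q⊆p x∈q , x∈q))

q⊈p⇒∃ : ∀ {n} {p q : Subset n} → q ⊈ p → ∃ λ z → z ∈ q × z ∉ p
q⊈p⇒∃ {p = p} {q} q⊈p with nonempty? (q ∩ ∁ p)
... | yes (z , z∈q∩∁p) with x∈p∩q⁻ q (∁ p) z∈q∩∁p
...   | z∈q , z∈∁p = z , z∈q , x∈∁p⇒x∉p z∈∁p
q⊈p⇒∃ {p = p} {q} q⊈p | no empty = contradiction (λ {z} → q⊆p {z}) q⊈p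
  where
  q⊆p : q ⊆ p
  q⊆p z∈q = x∉∁p⇒x∈p (λ z∈∁p → empty (_ , x∈p∩q⁺ (z∈q , z∈∁p)))

∣p∩q∣<∣q∣⇒∃ : ∀ {n} {p q : Subset n} → ∣ p ∩ q ∣ < ∣ q ∣ → ∃ λ z → z ∈ q × z ∉ p
∣p∩q∣<∣q∣⇒∃ small = q⊈p⇒∃ (λ q⊆p → <⇒≱ small (q⊆p⇒∣q∣≤∣p∩q∣ q⊆p))

∣p∣≢n⇒∃∉ : ∀ {n} {p : Subset n} → ∣ p ∣ ≢ n → ∃ λ z → z ∉ p
∣p∣≢n⇒∃∉ {n} {p} ∣p∣≢n with q⊈p⇒∃ {p = p} {q = ⊤} ⊤⊈p
  where
  ⊤⊈p : ⊤ ⊈ p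
  ⊤⊈p ⊤⊆p = ∣p∣≢n (≤-antisym (∣p∣≤n p)
                     (subst (_≤ ∣ p ∣) (∣⊤∣≡n n) (p⊆q⇒∣p∣≤∣q∣ ⊤⊆p)))
... | z , _ , z∉p = z , z∉p

sum-of-bounds : ∀ {n r m dx dy a c d Q} →
  n + 2 * r ≤ (dx + dy) + m → suc (dx + Q) ≤ a + d → 2 + dy ≤ r + c →
  a + c ≡ n → r + 3 + Q ≤ d + m
sum-of-bounds {n} {r} {m} {dx} {dy} {a} {c} {d} {Q} degree x-bound y-bound a+c≡n =
  +-cancelˡ-≤ (dx + dy + r + n) _ _ (begin
    (dx + dy + r + n) + (r + 3 + Q)
      ≡⟨ solve 5 (λ dx dy r n Q →
                    (dx :+ dy :+ r :+ n) :+ (r :+ con 3 :+ Q)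
                 := (n :+ con 2 :* r) :+ (con 1 :+ (dx :+ Q)) :+ (con 2 :+ dy))
               refl dx dy r n Q ⟩
    (n + 2 * r) + suc (dx + Q) + (2 + dy)
      ≤⟨ +-mono-≤ (+-mono-≤ degree x-bound) y-bound ⟩
    (dx + dy + m) + (a + d) + (r + c)
      ≡⟨ solve 7 (λ dx dy m a d r c →
                    (dx :+ dy :+ m) :+ (a :+ d) :+ (r :+ c)
                 := (dx :+ dy :+ r :+ (a :+ c)) :+ (d :+ m))
               refl dx dy m a d r c ⟩
    (dx + dy + r + (a + c)) + (d + m)
      ≡⟨ cong (λ s → (dx + dy + r + s) + (d + m)) a+c≡n ⟩
    (dx + dy + r + n) + (d + m) ∎)
  where
  open +-*-Solver
  open ≤-Reasoning

[a+m]⊖m≡a : ∀ a m → (a + m) ⊖ m ≡ + a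
[a+m]⊖m≡a a m = trans (⊖-≥ (m≤n+m m a)) (cong +_ (m+n∸n≡m a m))

⊖≤⇒≤+ : ∀ {a m b} → a ⊖ m ≤ℤ + b → a ≤ b + m
⊖≤⇒≤+ {a} {m} {b} le = drop‿+≤+ (subst (_≤ℤ + (b + m)) a⊖m+m≡a (+ℤ-monoˡ-≤ (+ m) le))
  where
  a⊖m+m≡a : a ⊖ m +ℤ + m ≡ + a
  a⊖m+m≡a = trans (distribˡ-⊖-+-pos m a m) ([a+m]⊖m≡a a m)

≤+⇒⊖≤ : ∀ {a m b} → a ≤ b + m → a ⊖ m ≤ℤ + b
≤+⇒⊖≤ {a} {m} {b} le = subst (a ⊖ m ≤ℤ_) ([a+m]⊖m≡a b m) (⊖-monoˡ-≤ m le)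

[+a-+m]++k≡[a+k]⊖m : ∀ a m k → (+ a - + m) +ℤ + k ≡ (a + k) ⊖ m
[+a-+m]++k≡[a+k]⊖m a m k =
  trans (cong (_+ℤ + k) ([+m]-[+n]≡m⊖n a m)) (distribˡ-⊖-+-pos k a m)

module Neighbourhoods {n : ℕ} (G : Graph n) where

  ∈N⇒adj : ∀ {v w} → w ∈ N G v → adj G v w ≡ true
  ∈N⇒adj {v} {w} w∈N = trans (Eq.sym (lookup∘tabulate (adj G v) w)) ([]=⇒lookup w∈N)

  ∉N⇒nonadjacent : ∀ {v w} → w ∉ N G v → adj G v w ≡ false
  ∉N⇒nonadjacent {v} {w} w∉N =
    ¬-not (λ adjacent → w∉N (lookup⇒[]= w (N G v) (trans (lookup∘tabulate (adj G v) w) adjacent)))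

  v∉N[v] : ∀ {v} → v ∉ N G v
  v∉N[v] {v} v∈N with trans (Eq.sym (∈N⇒adj v∈N)) (irrefl G v)
  ... | ()

  deg≡degIn+degIn∁ : ∀ A v → deg G v ≡ degIn G A v + degIn G (∁ A) v
  deg≡degIn+degIn∁ A v = Eq.sym (∣p∩q∣+∣p∩∁q∣≡∣p∣ (N G v) A)

  infected-in-one-step : ∀ {r A y} → r ≤ degIn G A y → y ∈ step G r A
  infected-in-one-step {r} {A} {y} r≤deg =
    x∈p∪q⁺ (inj₂ (lookup⇒[]= y _
      (trans (lookup∘tabulate _ y) (Equivalence.to T-≡ (≤⇒≤ᵇ r≤deg)))))

  closed⇒degIn<r : ∀ {r A y} → Closed G r A → y ∉ A → degIn G A y < r
  closed⇒degIn<r {r} {A} {y} (⟨A⟩⊆A , _) y∉A with r ≤? degIn G A y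
  ... | no r≰deg = ≰⇒> r≰deg
  ... | yes r≤deg = contradiction (⟨A⟩⊆A y (1 , infected-in-one-step r≤deg)) y∉A

  -- Neighbours of x in A and non-neighbours in A ∖ {x} split A ∖ {x}.
  degIn+q<∣A∣ : ∀ {A x} → x ∈ A → degIn G A x + q G A x < ∣ A ∣
  degIn+q<∣A∣ {A} {x} x∈A = begin-strict
    degIn G A x + q G A x
      ≤⟨ +-monoˡ-≤ (q G A x) (p⊆q⇒∣p∣≤∣q∣ N∩A⊆[A∖x]∩N) ⟩
    ∣ (A ∖ x) ∩ N G x ∣ + ∣ (A ∖ x) ∩ ∁ (N G x) ∣
      ≡⟨ ∣p∩q∣+∣p∩∁q∣≡∣p∣ (A ∖ x) (N G x) ⟩
    ∣ A ∖ x ∣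
      <⟨ x∈p⇒∣p-x∣<∣p∣ x∈A ⟩
    ∣ A ∣ ∎
    where
    open ≤-Reasoning
    N∩A⊆[A∖x]∩N : N G x ∩ A ⊆ (A ∖ x) ∩ N G x
    N∩A⊆[A∖x]∩N y∈N∩A with x∈p∩q⁻ (N G x) A y∈N∩A
    ... | y∈N , y∈A = x∈p∩q⁺ (x∈p∧x≢y⇒x∈p-y y∈A (λ { refl → v∉N[v] y∈N }) , y∈N)

  deg-inside : ∀ {A x} → x ∈ A → suc (deg G x + q G A x) ≤ ∣ A ∣ + degIn G (∁ A) x
  deg-inside {A} {x} x∈A = begin
    suc (deg G x + q G A x)
      ≡⟨ cong (λ d → suc (d + q G A x)) (deg≡degIn+degIn∁ A x) ⟩
    suc (degIn G A x + degIn G (∁ A) x + q G A x)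
      ≡⟨ cong suc (solve 3 (λ a c q → a :+ c :+ q := a :+ q :+ c) refl
                          (degIn G A x) (degIn G (∁ A) x) (q G A x)) ⟩
    suc (degIn G A x + q G A x) + degIn G (∁ A) x
      ≤⟨ +-monoˡ-≤ (degIn G (∁ A) x) (degIn+q<∣A∣ x∈A) ⟩
    ∣ A ∣ + degIn G (∁ A) x ∎
    where
    open +-*-Solver
    open ≤-Reasoning

  deg-outside : ∀ {r A y} → Closed G r A → y ∉ A → 2 + deg G y ≤ r + ∣ ∁ A ∣
  deg-outside {r} {A} {y} closed y∉A = begin
    2 + deg G y
      ≡⟨ cong (_+_ 2) (deg≡degIn+degIn∁ A y) ⟩
    2 + (degIn G A y + degIn G (∁ A) y)
      ≡⟨ cong suc (Eq.sym (+-suc (degIn G A y) (degIn G (∁ A) y))) ⟩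
    suc (degIn G A y) + suc (degIn G (∁ A) y)
      ≤⟨ +-mono-≤ (closed⇒degIn<r closed y∉A) (x∉p⇒∣p∩q∣<∣q∣ (x∉p⇒x∈∁p y∉A) v∉N[v]) ⟩
    r + ∣ ∁ A ∣ ∎
    where open ≤-Reasoning

module DegreeBounds {n : ℕ} (G : Graph n) (r m : ℕ)
  (degree-condition : ∀ v w → v ≢ w → adj G v w ≡ false →
                        n + 2 * r ≤ (deg G v + deg G w) + m)
  {A : Subset n} (closed : Closed G r A) where

  open Neighbourhoods G

  nonneighbour-bound : ∀ {x y} → x ∈ A → y ∉ A → adj G x y ≡ false →
                       r + 3 + q G A x ≤ degIn G (∁ A) x + m
  nonneighbour-bound {x} {y} x∈A y∉A nonadjacent =
    sum-of-bounds {dx = deg G x} {dy = deg G y} {d = degIn G (∁ A) x} {Q = q G A x}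
                  (degree-condition x y x≢y nonadjacent)
                  (deg-inside x∈A) (deg-outside closed y∉A) (∣p∣+∣∁p∣≡n A)
    where
    x≢y : x ≢ y
    x≢y refl = y∉A x∈A

  ∁A⊈N⇒bound : ∀ {x} → x ∈ A → ∁ A ⊈ N G x → r + 3 + q G A x ≤ degIn G (∁ A) x + m
  ∁A⊈N⇒bound x∈A ∁A⊈N with q⊈p⇒∃ ∁A⊈N
  ... | y , y∈∁A , y∉N = nonneighbour-bound x∈A (x∈∁p⇒x∉p y∈∁A) (∉N⇒nonadjacent y∉N)

  -- First claim.  If x is adjacent to all of Aᶜ, apply the second claim to a
  -- non-adjacent pair z ∈ A, y ∉ A, which exists since A ≠ V and r ≤ |A|.
  degree-bound : ∣ A ∣ ≢ n → r ≤ ∣ A ∣ → ∀ {x} → x ∈ A → r + 3 ≤ degIn G (∁ A) x + m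
  degree-bound ∣A∣≢n r≤∣A∣ {x} x∈A with ∁ A ⊆? N G x
  ... | no ∁A⊈N = ≤-trans (m≤m+n (r + 3) (q G A x)) (∁A⊈N⇒bound x∈A ∁A⊈N)
  ... | yes ∁A⊆N with ∣p∣≢n⇒∃∉ ∣A∣≢n
  ...   | y , y∉A with ∣p∩q∣<∣q∣⇒∃ (≤-trans (closed⇒degIn<r closed y∉A) r≤∣A∣)
  ...     | z , z∈A , z∉N[y] = begin
    r + 3                      ≤⟨ m≤m+n (r + 3) (q G A z) ⟩
    r + 3 + q G A z            ≤⟨ nonneighbour-bound z∈A y∉A z≁y ⟩
    degIn G (∁ A) z + m        ≤⟨ +-monoˡ-≤ m (∣p∩q∣≤∣q∣ (N G z) (∁ A)) ⟩
    ∣ ∁ A ∣ + m                ≤⟨ +-monoˡ-≤ m (q⊆p⇒∣q∣≤∣p∩q∣ ∁A⊆N) ⟩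
    degIn G (∁ A) x + m        ∎
    where
    open ≤-Reasoning
    z≁y : adj G z y ≡ false
    z≁y = trans (Graph.sym G z y) (∉N⇒nonadjacent z∉N[y])

lemma23 : (r m n : ℕ) (G : Graph n) →
    (∀ v w → v ≢ w → adj G v w ≡ false →
      (+ n +ℤ + (2 Data.Nat.* r)) - + m ≤ℤ + (deg G v Data.Nat.+ deg G w)) →
    (A : Subset n) → Closed G r A → ∣ A ∣ ≢ n → r ≤ ∣ A ∣ →
    ∀ x → x ∈ A →
      ((+ r - + m) +ℤ + 3 ≤ℤ + degIn G (∁ A) x)
      × (¬ (∀ y → y ∈ ∁ A → adj G x y ≡ true) →
          ((+ r - + m) +ℤ + 3) +ℤ + q G A x ≤ℤ + degIn G (∁ A) x)
lemma23 r m n G H A closed ∣A∣≢n r≤∣A∣ x x∈A =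
    subst (_≤ℤ _) (Eq.sym ([+a-+m]++k≡[a+k]⊖m r m 3))
          (≤+⇒⊖≤ (degree-bound ∣A∣≢n r≤∣A∣ x∈A))
  , λ notAllAdjacent → subst (_≤ℤ _) (Eq.sym lhs≡) (≤+⇒⊖≤ (∁A⊈N⇒bound x∈A
      (λ ∁A⊆N → notAllAdjacent (λ y y∈∁A → ∈N⇒adj (∁A⊆N y∈∁A)))))
  where
  degree-condition : ∀ v w → v ≢ w → adj G v w ≡ false →
                     n + 2 * r ≤ (deg G v + deg G w) + m
  degree-condition v w v≢w nonadjacent =
    ⊖≤⇒≤+ (subst (_≤ℤ _) ([+m]-[+n]≡m⊖n (n + 2 * r) m) (H v w v≢w nonadjacent))
  open Neighbourhoods G
  open DegreeBounds G r m degree-condition closed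
  lhs≡ : ((+ r - + m) +ℤ + 3) +ℤ + q G A x ≡ (r + 3 + q G A x) ⊖ m
  lhs≡ = trans (cong (_+ℤ + q G A x) ([+a-+m]++k≡[a+k]⊖m r m 3))
               (distribˡ-⊖-+-pos (q G A x) (r + 3) m)
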